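{- For all integers $k\ge 1$, $R_2(2;k) = O(k\log k)$.
   Context: $R_2(2;k)$ is the smallest integer $n$ such that for every coloring of the nonzero vectors of $\mathbb{F}_2^n$ with $k$ colors there exist distinct nonzero $x,y$ such that $x$, $y$ and $x+y$ all receive the same color (equivalently, every $k$-coloring of the $1$-dimensional subspaces of $\mathbb{F}_2^n$ has a monochromatic $2$-dimensional subspace). -}

module Defs where

open import Data.Nat using (ℕ; _≤_)
open import Data.Bool using (Bool; false; _xor_)
open import Data.Fin using (Fin)
open import Data.Vec using (Vec; zipWith; replicate)
open import Data.Product using (Σ; ∃; _×_)
open import Relation.Binary.PropositionalEquality using (_≡_; _≢_)

F2 : ℕ → Set
F2 n = Vec Bool n

𝟎 : (n : ℕ) → F2 n
𝟎 n = replicate n false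

_⊕_ : {n : ℕ} → F2 n → F2 n → F2 n
x ⊕ y = zipWith _xor_ x y

-- "n works for k": every k-coloring of (the nonzero vectors of) F₂ⁿ has
-- distinct nonzero x, y with x, y, x+y of the same colour.
-- (The colouring is given on all vectors; the value at 0 is irrelevant.)
Monochromatic : (n k : ℕ) → Set
Monochromatic n k =
  (c : F2 n → Fin k) →
  Σ (F2 n) λ x → Σ (F2 n) λ y →
    x ≢ 𝟎 n × y ≢ 𝟎 n × x ≢ y × c y ≡ c x × c (x ⊕ y) ≡ c x

-- R₂(2;k) ≤ m : since R₂(2;k) is the least n with the property,
-- this holds iff some n ≤ m has the property.
R₂2-≤ : ℕ → ℕ → Set
R₂2-≤ k m = ∃ λ n → n ≤ m × Monochromatic n k

{-# OPTIONS --safe #-}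
-- Colour each pair {a, b} of vectors of F₂ⁿ by c (a + b). A monochromatic
-- triangle a, b, d then yields the Schur triple x = a + b, y = a + d,
-- x + y = b + d. By the neighbourhood-pigeonhole argument, every k-colouring
-- of a complete graph on more than ramsey₃ k vertices has a monochromatic
-- triangle, and ramsey₃ k ≤ B ^ k for every B > k. Taking
-- B = 2 ^ (⌊log₂ k⌋ + 1), the dimension n = (⌊log₂ k⌋ + 1) k + 1 suffices.
module Submission where

open import Defs
open import Data.Nat using (ℕ; zero; suc; _+_; _*_; _^_; _≤_; _<_; s≤s; z<s; >-nonZero)
open import Data.Nat.Properties
open import Data.Nat.Logarithm using (⌊log₂_⌋; ⌊log₂⌋-mono-≤; ⌊log₂[2^n]⌋≡n)
open import Algebra.Properties.CommutativeSemigroup *-commutativeSemigroup using (xy∙z≈xz∙y)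
open import Data.Bool using (true; false)
open import Data.Bool.Properties using (xor-assoc; xor-comm; xor-identityˡ; xor-same)
open import Data.Fin using () renaming (_≟_ to _≟ᶠ_)
open import Data.Vec using ([]; _∷_)
open import Data.Vec.Properties using (∷-injectiveʳ; zipWith-assoc; zipWith-comm; zipWith-identityˡ)
open import Data.List using (List; []; _∷_; [_]; length; filter; map; _++_; allFin)
open import Data.List.Properties using (length-map; length-++; length-tabulate; filter-notAll)
open import Data.List.Membership.Propositional using (_∈_)
open import Data.List.Membership.Propositional.Properties using (∈-filter⁺; ∈-filter⁻; ∈-map⁻; ∈-allFin)
open import Data.List.Relation.Binary.Disjoint.Propositional using (Disjoint)
open import Data.List.Relation.Binary.Sublist.Propositional.Properties using (length-mono-≤; filter⁺; filter-⊆)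
open import Data.List.Relation.Unary.All as All using (All; []; _∷_)
open import Data.List.Relation.Unary.AllPairs using ([]; _∷_)
open import Data.List.Relation.Unary.Any as Any using (here; there)
open import Data.List.Relation.Unary.Unique.Propositional using (Unique)
import Data.List.Relation.Unary.Unique.Propositional.Properties as Unique
open import Data.Product using (∃; ∃₂; _×_; _,_)
open import Data.Sum as Sum using (_⊎_; inj₁; inj₂)
open import Function using (_∘_)
open import Relation.Nullary using (yes; no; ¬?; contradiction)
open import Relation.Unary using (Decidable)
open import Relation.Binary.Definitions using (DecidableEquality)
open import Relation.Binary.PropositionalEquality using (_≡_; _≢_; refl; sym; trans; cong; cong₂; subst; module ≡-Reasoning)

module _ {A : Set} {P : A → Set} (P? : Decidable P) where

  length-filter+filter-¬ : ∀ xs → length xs ≡ length (filter P? xs) + length (filter (¬? ∘ P?) xs)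
  length-filter+filter-¬ [] = refl
  length-filter+filter-¬ (x ∷ xs) with P? x
  ... | yes _ = cong suc (length-filter+filter-¬ xs)
  ... | no _  = trans (cong suc (length-filter+filter-¬ xs)) (sym (+-suc _ _))

∀∈-⊎ : ∀ {A T : Set} {P : A → Set} (xs : List A) →
       (∀ {x} → x ∈ xs → T ⊎ P x) → T ⊎ (∀ {x} → x ∈ xs → P x)
∀∈-⊎ [] _ = inj₂ λ ()
∀∈-⊎ (x ∷ xs) tp with tp (here refl) | ∀∈-⊎ xs (tp ∘ there)
... | inj₁ t | _       = inj₁ t
... | inj₂ _ | inj₁ t  = inj₁ t
... | inj₂ p | inj₂ ps = inj₂ λ { (here refl) → p ; (there x∈) → ps x∈ }

module _ {C : Set} (_≟_ : DecidableEquality C) where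

  pigeonhole : ∀ {A : Set} (f : A → C) (cols : List C) (xs : List A) {m} →
               (∀ {x} → x ∈ xs → f x ∈ cols) → length cols * m < length xs →
               ∃ λ i → i ∈ cols × m < length (filter (λ x → f x ≟ i) xs)
  pigeonhole f [] (x ∷ xs) into _ with into (here refl)
  ... | ()
  pigeonhole f (i ∷ cs) xs {m} into overfull with m <? length (filter (λ x → f x ≟ i) xs)
  ... | yes many = i , here refl , many
  ... | no few with pigeonhole f cs others into-cs overfull-others
    where
      others = filter (λ x → ¬? (f x ≟ i)) xs

      into-cs : ∀ {x} → x ∈ others → f x ∈ cs
      into-cs x∈ with ∈-filter⁻ (λ x → ¬? (f x ≟ i)) x∈
      ... | x∈xs , fx≢i with into x∈xs
      ...   | here fx≡i = contradiction fx≡i fx≢i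
      ...   | there fx∈cs = fx∈cs

      overfull-others : length cs * m < length others
      overfull-others = +-cancelˡ-< m _ _ (begin-strict
        m + length cs * m                                   <⟨ overfull ⟩
        length xs                                           ≡⟨ length-filter+filter-¬ (λ x → f x ≟ i) xs ⟩
        length (filter (λ x → f x ≟ i) xs) + length others  ≤⟨ +-monoˡ-≤ _ (≮⇒≥ few) ⟩
        m + length others                                   ∎)
        where open ≤-Reasoning
  ... | j , j∈cs , many = j , there j∈cs , <-≤-trans many
        (length-mono-≤ (filter⁺ (λ x → f x ≟ j) (λ x → f x ≟ j) (λ { refl p → p }) (filter-⊆ _ xs)))

-- R(3;k) ≤ ramsey₃ k + 1, from R(3;k+1) ≤ (k+1)(R(3;k) − 1) + 2.
ramsey₃ : ℕ → ℕ
ramsey₃ zero    = 1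
ramsey₃ (suc k) = suc (suc k * ramsey₃ k)

ramsey₃≤^ : ∀ {B} j → j < B → ramsey₃ j ≤ B ^ j
ramsey₃≤^ zero _ = ≤-refl
ramsey₃≤^ {B} (suc j) 1+j<B = begin
  suc (suc j * ramsey₃ j)   ≤⟨ s≤s (*-monoʳ-≤ (suc j) (ramsey₃≤^ j (<-trans (n<1+n j) 1+j<B))) ⟩
  1 + suc j * B ^ j         ≤⟨ +-monoˡ-≤ (suc j * B ^ j) (m^n>0 B j) ⟩
  suc (suc j) * B ^ j       ≤⟨ *-monoˡ-≤ (B ^ j) 1+j<B ⟩
  B ^ suc j                 ∎
  where
    open ≤-Reasoning
    instance _ = >-nonZero (<-≤-trans z<s 1+j<B)

module TriangleRamsey {A C : Set} (_≟_ : DecidableEquality C) (e : A → A → C) where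

  MonochromaticTriangle : Set
  MonochromaticTriangle = ∃ λ a → ∃ λ b → ∃ λ d →
    a ≢ b × a ≢ d × b ≢ d × e a d ≡ e a b × e b d ≡ e a b

  -- The alternative of a triangle stands in for the undecidable case split
  -- "some edge of W has the discarded colour".
  EdgesColouredBy : List A → List C → Set
  EdgesColouredBy W cols =
    ∀ {u u'} → u ∈ W → u' ∈ W → u ≢ u' → MonochromaticTriangle ⊎ e u u' ∈ cols

  neighbours : A → C → List A → List A
  neighbours v i = filter (λ u → e v u ≟ i)

  without : C → List C → List C
  without i = filter (λ j → ¬? (j ≟ i))

  neighbours-coloured-without : ∀ {v i cols rest} → All (v ≢_) rest →
    EdgesColouredBy (v ∷ rest) cols → EdgesColouredBy (neighbours v i rest) (without i cols)
  neighbours-coloured-without {v} {i} v∉rest coloured {u} {u'} u∈N u'∈N u≢u'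
    with ∈-filter⁻ (λ u → e v u ≟ i) u∈N | ∈-filter⁻ (λ u → e v u ≟ i) u'∈N
  ... | u∈rest , vu≡i | u'∈rest , vu'≡i with e u u' ≟ i
  ... | yes uu'≡i = inj₁ (v , u , u' , All.lookup v∉rest u∈rest , All.lookup v∉rest u'∈rest , u≢u' ,
                          trans vu'≡i (sym vu≡i) , trans uu'≡i (sym vu≡i))
  ... | no uu'≢i  = Sum.map₂ (λ uu'∈cols → ∈-filter⁺ (λ j → ¬? (j ≟ i)) uu'∈cols uu'≢i)
                              (coloured (there u∈rest) (there u'∈rest) u≢u')

  length-without : ∀ {i cols} → i ∈ cols → length (without i cols) < length cols
  length-without {i} {cols} i∈cols =
    filter-notAll (λ j → ¬? (j ≟ i)) cols (Any.map (λ i≡j j≢i → j≢i (sym i≡j)) i∈cols)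

  monochromaticTriangle : ∀ k (cols : List C) (W : List A) → length cols ≤ k → Unique W →
    ramsey₃ k < length W → EdgesColouredBy W cols → MonochromaticTriangle
  monochromaticTriangle zero [] (_ ∷ []) _ _ (s≤s ()) _
  monochromaticTriangle zero [] (u ∷ u' ∷ _) _ ((u≢u' ∷ _) ∷ _) _ coloured
    with coloured (here refl) (there (here refl)) u≢u'
  ... | inj₁ triangle = triangle
  monochromaticTriangle (suc k) cols (v ∷ rest) |cols|≤1+k (v∉rest ∷ unique) (s≤s overfull) coloured
    with ∀∈-⊎ rest (λ u∈ → coloured (here refl) (there u∈) (All.lookup v∉rest u∈))
  ... | inj₁ triangle = triangle
  ... | inj₂ into-cols
    with pigeonhole _≟_ (e v) cols rest into-cols (≤-<-trans (*-monoˡ-≤ (ramsey₃ k) |cols|≤1+k) overfull)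
  ... | i , i∈cols , many =
    monochromaticTriangle k (without i cols) (neighbours v i rest)
      (≤-pred (<-≤-trans (length-without i∈cols) |cols|≤1+k))
      (Unique.filter⁺ (λ u → e v u ≟ i) unique) many
      (neighbours-coloured-without v∉rest coloured)

⊕-assoc : ∀ {n} (x y z : F2 n) → (x ⊕ y) ⊕ z ≡ x ⊕ (y ⊕ z)
⊕-assoc = zipWith-assoc xor-assoc

⊕-comm : ∀ {n} (x y : F2 n) → x ⊕ y ≡ y ⊕ x
⊕-comm = zipWith-comm xor-comm

⊕-identityˡ : ∀ {n} (x : F2 n) → 𝟎 n ⊕ x ≡ x
⊕-identityˡ = zipWith-identityˡ xor-identityˡ

⊕-same : ∀ {n} (x : F2 n) → x ⊕ x ≡ 𝟎 n
⊕-same []      = refl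
⊕-same (b ∷ x) = cong₂ _∷_ (xor-same b) (⊕-same x)

⊕-involutiveˡ : ∀ {n} (x y : F2 n) → x ⊕ (x ⊕ y) ≡ y
⊕-involutiveˡ {n} x y = begin
  x ⊕ (x ⊕ y)   ≡⟨ sym (⊕-assoc x x y) ⟩
  (x ⊕ x) ⊕ y   ≡⟨ cong (_⊕ y) (⊕-same x) ⟩
  𝟎 n ⊕ y       ≡⟨ ⊕-identityˡ y ⟩
  y             ∎
  where open ≡-Reasoning

⊕-cancelˡ : ∀ {n} (x y z : F2 n) → x ⊕ y ≡ x ⊕ z → y ≡ z
⊕-cancelˡ x y z eq = trans (sym (⊕-involutiveˡ x y)) (trans (cong (x ⊕_) eq) (⊕-involutiveˡ x z))

⊕≡𝟎⇒≡ : ∀ {n} (x y : F2 n) → x ⊕ y ≡ 𝟎 n → x ≡ y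
⊕≡𝟎⇒≡ x y eq = ⊕-cancelˡ x x y (trans (⊕-same x) (sym eq))

⊕-⊕-shared : ∀ {n} (x y z : F2 n) → (x ⊕ y) ⊕ (x ⊕ z) ≡ y ⊕ z
⊕-⊕-shared x y z = begin
  (x ⊕ y) ⊕ (x ⊕ z)   ≡⟨ cong (_⊕ (x ⊕ z)) (⊕-comm x y) ⟩
  (y ⊕ x) ⊕ (x ⊕ z)   ≡⟨ ⊕-assoc y x (x ⊕ z) ⟩
  y ⊕ (x ⊕ (x ⊕ z))   ≡⟨ cong (y ⊕_) (⊕-involutiveˡ x z) ⟩
  y ⊕ z               ∎
  where open ≡-Reasoning

allF2 : ∀ n → List (F2 n)
allF2 zero    = [ [] ]
allF2 (suc n) = map (true ∷_) (allF2 n) ++ map (false ∷_) (allF2 n)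

length-allF2 : ∀ n → length (allF2 n) ≡ 2 ^ n
length-allF2 zero    = refl
length-allF2 (suc n) = begin
  length (map (true ∷_) (allF2 n) ++ map (false ∷_) (allF2 n))  ≡⟨ length-++ (map (true ∷_) (allF2 n)) ⟩
  length (map (true ∷_) (allF2 n)) + length (map (false ∷_) (allF2 n))
    ≡⟨ cong₂ _+_ (length-map (true ∷_) (allF2 n)) (length-map (false ∷_) (allF2 n)) ⟩
  length (allF2 n) + length (allF2 n)  ≡⟨ cong (λ m → m + m) (length-allF2 n) ⟩
  2 ^ n + 2 ^ n                        ≡⟨ cong (2 ^ n +_) (sym (+-identityʳ (2 ^ n))) ⟩
  2 ^ suc n                            ∎
  where open ≡-Reasoning

allF2-unique : ∀ n → Unique (allF2 n)
allF2-unique zero    = [] ∷ []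
allF2-unique (suc n) = Unique.++⁺ (Unique.map⁺ ∷-injectiveʳ (allF2-unique n))
                                  (Unique.map⁺ ∷-injectiveʳ (allF2-unique n)) heads-differ
  where
    heads-differ : Disjoint (map (true ∷_) (allF2 n)) (map (false ∷_) (allF2 n))
    heads-differ (v∈ , v∈') with ∈-map⁻ (true ∷_) v∈ | ∈-map⁻ (false ∷_) v∈'
    ... | _ , _ , refl | _ , _ , ()

ramsey₃<2^⇒Monochromatic : ∀ {n k} → ramsey₃ k < 2 ^ n → Monochromatic n k
ramsey₃<2^⇒Monochromatic {n} {k} overfull c
  with monochromaticTriangle k (allFin k) (allF2 n) (≤-reflexive (length-tabulate _)) (allF2-unique n)
         (subst (ramsey₃ k <_) (sym (length-allF2 n)) overfull) (λ _ _ _ → inj₂ (∈-allFin _))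
  where open TriangleRamsey _≟ᶠ_ (λ a b → c (a ⊕ b))
... | a , b , d , a≢b , a≢d , b≢d , c[a+d]≡c[a+b] , c[b+d]≡c[a+b] =
  a ⊕ b , a ⊕ d , a≢b ∘ ⊕≡𝟎⇒≡ a b , a≢d ∘ ⊕≡𝟎⇒≡ a d , b≢d ∘ ⊕-cancelˡ a b d , c[a+d]≡c[a+b] ,
  trans (cong c (⊕-⊕-shared a b d)) c[b+d]≡c[a+b]

Monochromatic-1+P*k : ∀ {P k} → k < 2 ^ P → Monochromatic (suc (P * k)) k
Monochromatic-1+P*k {P} {k} k<2^P = ramsey₃<2^⇒Monochromatic (begin-strict
  ramsey₃ k         ≤⟨ ramsey₃≤^ k k<2^P ⟩
  (2 ^ P) ^ k       ≡⟨ ^-*-assoc 2 P k ⟩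
  2 ^ (P * k)       <⟨ ^-monoʳ-< 2 (n<1+n 1) (n<1+n (P * k)) ⟩
  2 ^ suc (P * k)   ∎)
  where open ≤-Reasoning

<2^suc⌊log₂⌋ : ∀ k → k < 2 ^ suc ⌊log₂ k ⌋
<2^suc⌊log₂⌋ k = ≰⇒> λ 2^[1+L]≤k →
  1+n≰n (subst (_≤ ⌊log₂ k ⌋) (⌊log₂[2^n]⌋≡n (suc ⌊log₂ k ⌋)) (⌊log₂⌋-mono-≤ 2^[1+L]≤k))

1≤⌊log₂⌋ : ∀ {k} → 2 ≤ k → 1 ≤ ⌊log₂ k ⌋
1≤⌊log₂⌋ {k} 2≤k = subst (_≤ ⌊log₂ k ⌋) (⌊log₂[2^n]⌋≡n 1) (⌊log₂⌋-mono-≤ 2≤k)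

1+[1+L]*k≤3*k*L : ∀ {k L} → 1 ≤ k → 1 ≤ L → suc (suc L * k) ≤ 3 * k * L
1+[1+L]*k≤3*k*L {k} {L} 1≤k 1≤L = begin
  1 + suc L * k     ≤⟨ +-monoˡ-≤ (suc L * k) 1≤k ⟩
  (2 + L) * k       ≤⟨ *-monoˡ-≤ k 2+L≤3*L ⟩
  3 * L * k         ≡⟨ xy∙z≈xz∙y 3 L k ⟩
  3 * k * L         ∎
  where
    open ≤-Reasoning
    2+L≤3*L : 2 + L ≤ 3 * L
    2+L≤3*L = ≤-trans (≤-reflexive (+-comm 2 L)) (+-monoʳ-≤ L (*-monoʳ-≤ 2 1≤L))

theorem1p6 : ∃₂ λ (C K : ℕ) → ∀ (k : ℕ) → K ≤ k → R₂2-≤ k (C * k * ⌊log₂ k ⌋)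
theorem1p6 = 3 , 2 , λ k 2≤k →
  suc (suc ⌊log₂ k ⌋ * k) ,
  1+[1+L]*k≤3*k*L (≤-trans (n≤1+n 1) 2≤k) (1≤⌊log₂⌋ 2≤k) ,
  Monochromatic-1+P*k {suc ⌊log₂ k ⌋} (<2^suc⌊log₂⌋ k)
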